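{- For every $\varphi\in\mathsf{Form}_\Box$: if $\mathcal{CMM}\models\varphi$, then $\mathcal{BM}+\mathsf{BEM}\models\varphi$.
   Context: The modal language $\mathsf{Form}_\Box$ is generated by $\top$, $\bot$, propositional variables $p\in\mathsf{Prop}$, $\wedge,\vee,\to$ and $\Box$. A concrete mixed model is $\langle W,R,\{\mathcal M_w\}_{w\in W}\rangle$ with $W\ne\emptyset$, $R\subseteq W\times W$, each $\mathcal M_w=\langle W_w,\leq_w,V_w\rangle$ a rooted intuitionistic Kripke model (partial order $\leq_w$ with least element $\overline w$, valuation $V_w:W_w\to\mathcal P(\mathsf{Prop})$ monotone in $\leq_w$), the $W_w$ pairwise disjoint; $\leq,V$ denote the unions. Forcing at a point $x\in\bigcup_wW_w$: $x\Vdash p$ iff $p\in V(x)$; $x\nVdash\bot$; $\wedge,\vee$ pointwise; $x\Vdash\varphi\to\psi$ iff every $y\geq x$ forcing $\varphi$ forces $\psi$; $x\Vdash\Box\varphi$ iff $\overline v\Vdash\varphi$ for all $v\in W$ with $wRv$, where $w$ is the unique element with $\overline w\leq x$. $\mathcal{CMM}\models\varphi$ means $\varphi$ is forced at every point of every concrete mixed model. A birelational model is $\langle U,\leq,R,V\rangle$ with $U\ne\emptyset$, $\leq$ a partial order, $R\subseteq U\times U$ such that $x\leq y$ and $yRz$ imply $xRz$, and $V:U\to\mathcal P(\mathsf{Prop})$ monotone in $\leq$; forcing uses the same propositional clauses and $x\Vdash\Box\varphi$ iff $y\Vdash\varphi$ for all $y$ with $xRy$. The condition $\mathsf{BEM}$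 is: $x\leq y$ and $xRz$ imply $yRz$. $\mathcal{BM}+\mathsf{BEM}\models\varphi$ means $\varphi$ is forced at every world of every birelational model satisfying $\mathsf{BEM}$. -}

module Defs where

open import Data.Nat using (ℕ)
open import Data.Unit using (⊤)
open import Data.Empty using (⊥)
open import Data.Product using (_×_)
open import Data.Sum using (_⊎_)
open import Relation.Binary.PropositionalEquality using (_≡_)
open import Relation.Binary.Structures using (IsPartialOrder)

Prop : Set
Prop = ℕ

data Form : Set where
  ⊤f   : Form
  ⊥f   : Form
  var  : Prop → Form
  _∧f_ : Form → Form → Form
  _∨f_ : Form → Form → Form
  _⇒f_ : Form → Form → Form
  □f   : Form → Form

-- The disjoint union of the W_w is represented as the dependent sum of the
-- families Pt w (so disjointness is automatic); a point x of ⋃ W_w is a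
-- pair (w , a) with a : Pt w, and w is the unique world with root w ≤ x.

record CMM : Set₁ where
  field
    W        : Set
    w₀       : W                         -- W ≠ ∅
    R        : W → W → Set
    Pt       : W → Set
    le       : (w : W) → Pt w → Pt w → Set
    le-po    : (w : W) → IsPartialOrder _≡_ (le w)
    root     : (w : W) → Pt w
    root-least : (w : W) (a : Pt w) → le w (root w) a
    V        : (w : W) → Pt w → Prop → Set
    V-mono   : (w : W) {a b : Pt w} {p : Prop} → le w a b → V w a p → V w b p

CMM-forces : (M : CMM) (w : CMM.W M) → CMM.Pt M w → Form → Set
CMM-forces M w a ⊤f = ⊤
CMM-forces M w a ⊥f = ⊥
CMM-forces M w a (var p) = CMM.V M w a p
CMM-forces M w a (φ ∧f ψ) = CMM-forces M w a φ × CMM-forces M w a ψ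
CMM-forces M w a (φ ∨f ψ) = CMM-forces M w a φ ⊎ CMM-forces M w a ψ
CMM-forces M w a (φ ⇒f ψ) =
  (b : CMM.Pt M w) → CMM.le M w a b → CMM-forces M w b φ → CMM-forces M w b ψ
CMM-forces M w a (□f φ) =
  (v : CMM.W M) → CMM.R M w v → CMM-forces M v (CMM.root M v) φ

CMM⊨ : Form → Set₁
CMM⊨ φ = (M : CMM) (w : CMM.W M) (a : CMM.Pt M w) → CMM-forces M w a φ

record BM : Set₁ where
  field
    U      : Set
    u₀     : U                           -- U ≠ ∅
    _≤_    : U → U → Set
    ≤-po   : IsPartialOrder _≡_ _≤_
    R      : U → U → Set
    R-down : {x y z : U} → x ≤ y → R y z → R x z
    V      : U → Prop → Set
    V-mono : {x y : U} {p : Prop} → x ≤ y → V x p → V y p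

BEM : BM → Set
BEM B = {x y z : BM.U B} → BM._≤_ B x y → BM.R B x z → BM.R B y z

BM-forces : (B : BM) → BM.U B → Form → Set
BM-forces B x ⊤f = ⊤
BM-forces B x ⊥f = ⊥
BM-forces B x (var p) = BM.V B x p
BM-forces B x (φ ∧f ψ) = BM-forces B x φ × BM-forces B x ψ
BM-forces B x (φ ∨f ψ) = BM-forces B x φ ⊎ BM-forces B x ψ
BM-forces B x (φ ⇒f ψ) =
  (y : BM.U B) → BM._≤_ B x y → BM-forces B y φ → BM-forces B y ψ
BM-forces B x (□f φ) = (y : BM.U B) → BM.R B x y → BM-forces B y φ

BM+BEM⊨ : Form → Set₁
BM+BEM⊨ φ = (B : BM) → BEM B → (x : BM.U B) → BM-forces B x φ

{-# OPTIONS --safe #-}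
module Submission where

-- Every birelational model B satisfying BEM is matched by a concrete mixed model
-- with the same worlds and the same R, whose component at w is the unravelling of
-- the cone above w: finite ≤-chains starting at w, ordered by extension.  Sending a
-- chain to its last element preserves and reflects forcing.  Implications go through
-- because a chain can always be extended by one step.  Boxes go through because □ in
-- a component is evaluated at its root w, and for w ≤ x, R-down and BEM together say
-- that w and x have the same R-successors.

open import Level using (Level; _⊔_)
open import Data.Nat using (ℕ; zero; suc) renaming (_≤_ to _≤ℕ_)
open import Data.Nat.Properties using (≤-refl; ≤-trans; m≤n⇒m≤1+n; 1+n≰n)
open import Data.Empty using (⊥-elim)
open import Data.Product using (_,_)
open import Data.Sum using (inj₁; inj₂)
open import Relation.Binary.Core using (Rel)
open import Relation.Binary.Structures using (IsPreorder; IsPartialOrder)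
open import Relation.Binary.PropositionalEquality using (_≡_; refl; isEquivalence)

open import Defs

-- Chains rather than the cone {x | w ≤ x} itself: the components must be partially
-- ordered up to _≡_, and proofs of w ≤ x need not be unique.
module Unravelling {a ℓ : Level} {U : Set a} (_≼_ : Rel U ℓ) where

  data Chain (w : U) : Set (a ⊔ ℓ)
  last : {w : U} → Chain w → U

  data Chain w where
    nil  : Chain w
    snoc : (c : Chain w) (x : U) → last c ≼ x → Chain w

  last {w} nil = w
  last (snoc c x _) = x

  length : {w : U} → Chain w → ℕ
  length nil = zero
  length (snoc c _ _) = suc (length c)

  data _⊑_ {w : U} : Rel (Chain w) (a ⊔ ℓ) where
    ⊑-refl : {c : Chain w} → c ⊑ c
    ⊑-snoc : {c d : Chain w} {x : U} {p : last d ≼ x} → c ⊑ d → c ⊑ snoc d x p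

  ⊑-trans : {w : U} {c d e : Chain w} → c ⊑ d → d ⊑ e → c ⊑ e
  ⊑-trans c⊑d ⊑-refl = c⊑d
  ⊑-trans c⊑d (⊑-snoc d⊑e) = ⊑-snoc (⊑-trans c⊑d d⊑e)

  ⊑⇒length≤ : {w : U} {c d : Chain w} → c ⊑ d → length c ≤ℕ length d
  ⊑⇒length≤ ⊑-refl = ≤-refl
  ⊑⇒length≤ (⊑-snoc c⊑d) = m≤n⇒m≤1+n (⊑⇒length≤ c⊑d)

  ⊑-antisym : {w : U} {c d : Chain w} → c ⊑ d → d ⊑ c → c ≡ d
  ⊑-antisym ⊑-refl _ = refl
  ⊑-antisym (⊑-snoc c⊑d) d'⊑c =
    ⊥-elim (1+n≰n (≤-trans (⊑⇒length≤ d'⊑c) (⊑⇒length≤ c⊑d)))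

  ⊑-isPartialOrder : (w : U) → IsPartialOrder _≡_ (_⊑_ {w})
  ⊑-isPartialOrder w = record
    { isPreorder = record
      { isEquivalence = isEquivalence
      ; reflexive = λ { refl → ⊑-refl }
      ; trans = ⊑-trans
      }
    ; antisym = ⊑-antisym
    }

  nil⊑ : {w : U} (c : Chain w) → nil ⊑ c
  nil⊑ nil = ⊑-refl
  nil⊑ (snoc c _ _) = ⊑-snoc (nil⊑ c)

  module _ (≼-isPreorder : IsPreorder _≡_ _≼_) where
    open IsPreorder ≼-isPreorder using () renaming (refl to ≼-refl; trans to ≼-trans)

    last-mono : {w : U} {c d : Chain w} → c ⊑ d → last c ≼ last d
    last-mono ⊑-refl = ≼-refl
    last-mono {d = snoc _ _ p} (⊑-snoc c⊑d) = ≼-trans (last-mono c⊑d) p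

    root≼last : {w : U} (c : Chain w) → w ≼ last c
    root≼last c = last-mono (nil⊑ c)

module _ (B : BM) (bem : BEM B) where
  open BM B
  open Unravelling _≤_
  open IsPartialOrder ≤-po using (isPreorder)

  unravel : CMM
  unravel = record
    { W = U
    ; w₀ = u₀
    ; R = R
    ; Pt = Chain
    ; le = λ _ → _⊑_
    ; le-po = ⊑-isPartialOrder
    ; root = λ _ → nil
    ; root-least = λ _ → nil⊑
    ; V = λ _ c → V (last c)
    ; V-mono = λ _ c⊑d → V-mono (last-mono isPreorder c⊑d)
    }

  unravel⇒BM-forces : (φ : Form) (w : U) (c : Chain w) →
                      CMM-forces unravel w c φ → BM-forces B (last c) φ
  BM⇒unravel-forces : (φ : Form) (w : U) (c : Chain w) →
                      BM-forces B (last c) φ → CMM-forces unravel w c φ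

  unravel⇒BM-forces ⊤f w c f = f
  unravel⇒BM-forces ⊥f w c f = f
  unravel⇒BM-forces (var p) w c f = f
  unravel⇒BM-forces (φ ∧f ψ) w c (f , g) =
    unravel⇒BM-forces φ w c f , unravel⇒BM-forces ψ w c g
  unravel⇒BM-forces (φ ∨f ψ) w c (inj₁ f) = inj₁ (unravel⇒BM-forces φ w c f)
  unravel⇒BM-forces (φ ∨f ψ) w c (inj₂ g) = inj₂ (unravel⇒BM-forces ψ w c g)
  unravel⇒BM-forces (φ ⇒f ψ) w c f y c≤y fy =
    unravel⇒BM-forces ψ w d (f d (⊑-snoc ⊑-refl) (BM⇒unravel-forces φ w d fy))
    where d = snoc c y c≤y
  unravel⇒BM-forces (□f φ) w c f y cRy =
    unravel⇒BM-forces φ y nil (f y (R-down (root≼last isPreorder c) cRy))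

  BM⇒unravel-forces ⊤f w c f = f
  BM⇒unravel-forces ⊥f w c f = f
  BM⇒unravel-forces (var p) w c f = f
  BM⇒unravel-forces (φ ∧f ψ) w c (f , g) =
    BM⇒unravel-forces φ w c f , BM⇒unravel-forces ψ w c g
  BM⇒unravel-forces (φ ∨f ψ) w c (inj₁ f) = inj₁ (BM⇒unravel-forces φ w c f)
  BM⇒unravel-forces (φ ∨f ψ) w c (inj₂ g) = inj₂ (BM⇒unravel-forces ψ w c g)
  BM⇒unravel-forces (φ ⇒f ψ) w c f d c⊑d fd =
    BM⇒unravel-forces ψ w d
      (f (last d) (last-mono isPreorder c⊑d) (unravel⇒BM-forces φ w d fd))
  BM⇒unravel-forces (□f φ) w c f v wRv =
    BM⇒unravel-forces φ v nil (f v (bem (root≼last isPreorder c) wRv))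

open Unravelling using (nil)

theorem3p3p2 : (φ : Form) → CMM⊨ φ → BM+BEM⊨ φ
theorem3p3p2 φ CMM⊨φ B bem x =
  unravel⇒BM-forces B bem φ x nil (CMM⊨φ (unravel B bem) x nil)
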